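{- For $n\ge1$ let $\chi_n=\sum_{k=0}^{\lfloor n/2\rfloor}(-1)^k\frac{n!}{2^k}\binom{n-k}{k}$. Then $\chi_1=\chi_2=1$ and $\chi_n=n\,\chi_{n-1}-\binom{n}{2}\chi_{n-2}$ for all $n\ge3$. -}

module Defs where

open import Data.Nat as ℕ using (ℕ; zero; suc; _^_; _∸_; ⌊_/2⌋; _!)
open import Data.Nat.Properties using (m^n≢0)
open import Data.Nat.Combinatorics using (_C_)
open import Data.Integer as ℤ using (ℤ; +_)
open import Data.Rational as ℚ using (ℚ; _/_; _+_; _*_; _-_; -_; 0ℚ)
open import Data.List using (List; upTo; map; foldr)

sign : ℕ → ℚ
sign zero = ℚ.1ℚ
sign (suc k) = - sign k

term : ℕ → ℕ → ℚ
term n k = sign k * (((+ (n !)) / (2 ^ k)) {{m^n≢0 2 k}} * ((+ ((n ∸ k) C k)) / 1))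

χ : ℕ → ℚ
χ n = foldr _+_ 0ℚ (map (term n) (upTo (suc ⌊ n /2⌋)))

choose2 : ℕ → ℚ
choose2 n = (+ (n C 2)) / 1

fromℕ : ℕ → ℚ
fromℕ n = (+ n) / 1

module Submission where

-- Write T(n,k) = (-1)^k · n!/2^k · C(n-k,k) for the k-th summand ('term n k'), so that
-- χ n = Σ_{k ≤ ⌊n/2⌋} T(n,k).  For n = m + 2
-- the recurrence is obtained summand by summand:
--   T(n,0)   = n · T(n-1,0),
--   T(n,k+1) = n · T(n-1,k+1) − C(n,2) · T(n-2,k),
-- consequences of n! = n·(n-1)·(n-2)!, C(n,2) = n(n-1)/2, 1/2^(k+1) = 1/2^k · 1/2 and the
-- shifted Pascal rule C(m+1-k,k+1) = C(m-k,k) + C(m-k,k+1).  As T(n,k) = 0 for k > ⌊n/2⌋, χ n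
-- is also the sum of T(n,k) over 0 ≤ k < M for every M > n, so χ n, χ(n-1), χ(n-2) can be
-- summed over one common range, and linearity of the sum turns the summand identities into
-- χ n = n χ(n-1) − C(n,2) χ(n-2).

open import Data.Product using (_×_; _,_)
open import Data.Nat as ℕ using (ℕ; suc; zero; _∸_; _!; _^_; ⌊_/2⌋; _≤_; _<_; _≥_; z≤n; s≤s)
import Data.Nat.Properties as ℕP
open import Data.Nat.Combinatorics using (_C_; k>n⇒nCk≡0; nCk+nC[k+1]≡[n+1]C[k+1]; nC1≡n)
open import Data.Nat.Tactic.RingSolver using () renaming (solve to ℕ-solve)
open import Data.Integer as ℤ using (+_)
import Data.Integer.Properties as ℤP
open import Data.Rational as ℚ using (ℚ; 1ℚ; 0ℚ; _*_; _+_; _-_; _/_; -_)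
import Data.Rational.Properties as ℚP
import Data.Rational.Unnormalised as ℚᵘ
import Data.Rational.Unnormalised.Properties as ℚᵘP
open import Data.Rational.Solver using (module +-*-Solver)
open +-*-Solver using (solve; _:+_; _:*_; :-_; _:-_; _:=_; con)
open import Data.List using (foldr; applyUpTo; _∷_; [])
open import Data.List.Properties using (map-upTo)
open import Relation.Binary.PropositionalEquality
open import Relation.Nullary using (yes; no)
open import Defs

/-*-/ : ∀ a b c d .{{_ : ℕ.NonZero b}} .{{_ : ℕ.NonZero d}} →
        (+ a / b) * (+ c / d) ≡ (+ (a ℕ.* c) / (b ℕ.* d)) {{ℕP.m*n≢0 b d}}
/-*-/ a (suc b) c (suc d) = ℚP.toℚᵘ-injective (begin
    ℚ.toℚᵘ (+ a / suc b * (+ c / suc d))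
      ≈⟨ ℚP.toℚᵘ-homo-* (+ a / suc b) (+ c / suc d) ⟩
    ℚ.toℚᵘ (+ a / suc b) ℚᵘ.* ℚ.toℚᵘ (+ c / suc d)
      ≈⟨ ℚᵘP.*-cong (ℚP.toℚᵘ-fromℚᵘ (ℚᵘ.mkℚᵘ (+ a) b)) (ℚP.toℚᵘ-fromℚᵘ (ℚᵘ.mkℚᵘ (+ c) d)) ⟩
    ℚᵘ.mkℚᵘ (+ a ℤ.* + c) (d ℕ.+ b ℕ.* suc d)
      ≡⟨ cong (λ z → ℚᵘ.mkℚᵘ z (d ℕ.+ b ℕ.* suc d)) (sym (ℤP.pos-* a c)) ⟩
    ℚᵘ.mkℚᵘ (+ (a ℕ.* c)) (d ℕ.+ b ℕ.* suc d)
      ≈⟨ ℚᵘP.≃-sym (ℚP.toℚᵘ-fromℚᵘ (ℚᵘ.mkℚᵘ (+ (a ℕ.* c)) (d ℕ.+ b ℕ.* suc d))) ⟩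
    ℚ.toℚᵘ (+ (a ℕ.* c) / (suc b ℕ.* suc d)) ∎)
  where open ℚᵘP.≃-Reasoning

fromℕ-* : ∀ a c → fromℕ a * fromℕ c ≡ fromℕ (a ℕ.* c)
fromℕ-* a c = /-*-/ a 1 c 1

fromℕ-+ : ∀ a c → fromℕ a + fromℕ c ≡ fromℕ (a ℕ.+ c)
fromℕ-+ a c = ℚP.toℚᵘ-injective (begin
    ℚ.toℚᵘ (fromℕ a + fromℕ c)
      ≈⟨ ℚP.toℚᵘ-homo-+ (fromℕ a) (fromℕ c) ⟩
    ℚ.toℚᵘ (fromℕ a) ℚᵘ.+ ℚ.toℚᵘ (fromℕ c)
      ≈⟨ ℚᵘP.+-cong (ℚP.toℚᵘ-fromℚᵘ (ℚᵘ.mkℚᵘ (+ a) 0)) (ℚP.toℚᵘ-fromℚᵘ (ℚᵘ.mkℚᵘ (+ c) 0)) ⟩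
    ℚᵘ.mkℚᵘ (+ a ℤ.* + 1 ℤ.+ + c ℤ.* + 1) 0
      ≡⟨ cong (λ z → ℚᵘ.mkℚᵘ z 0) numerator ⟩
    ℚᵘ.mkℚᵘ (+ (a ℕ.+ c)) 0
      ≈⟨ ℚᵘP.≃-sym (ℚP.toℚᵘ-fromℚᵘ (ℚᵘ.mkℚᵘ (+ (a ℕ.+ c)) 0)) ⟩
    ℚ.toℚᵘ (fromℕ (a ℕ.+ c)) ∎)
  where
  open ℚᵘP.≃-Reasoning
  numerator : + a ℤ.* + 1 ℤ.+ + c ℤ.* + 1 ≡ + (a ℕ.+ c)
  numerator = trans (cong₂ ℤ._+_ (ℤP.*-identityʳ (+ a)) (ℤP.*-identityʳ (+ c))) (sym (ℤP.pos-+ a c))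

-- Equational reasoning on ℚ from here on; it is opened only now because its notation would
-- clash with the ℚᵘ setoid reasoning used above.
open ≡-Reasoning

half : ℚ
half = + 1 / 2

half^ : ℕ → ℚ
half^ k = (+ 1 / 2 ^ k) {{ℕP.m^n≢0 2 k}}

/2^-as-product : ∀ a k → (+ a / 2 ^ k) {{ℕP.m^n≢0 2 k}} ≡ fromℕ a * half^ k
/2^-as-product a k = sym (trans (/-*-/ a 1 1 (2 ^ k) {{ℕ.nonZero}} {{ℕP.m^n≢0 2 k}})
  (ℚP./-cong {p₁ = + (a ℕ.* 1)} {{ℕP.m*n≢0 1 (2 ^ k) {{ℕ.nonZero}} {{ℕP.m^n≢0 2 k}}}} {{ℕP.m^n≢0 2 k}}
     (cong +_ (ℕP.*-identityʳ a)) (ℕP.*-identityˡ (2 ^ k))))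

half^-suc : ∀ k → half^ (suc k) ≡ half^ k * half
half^-suc k = sym (trans (/-*-/ 1 (2 ^ k) 1 2 {{ℕP.m^n≢0 2 k}})
  (ℚP./-cong {p₁ = + 1} {{ℕP.m*n≢0 (2 ^ k) 2 {{ℕP.m^n≢0 2 k}}}} {{ℕP.m^n≢0 2 (suc k)}}
     refl (ℕP.*-comm (2 ^ k) 2)))

-- Σ_{i<N} f i, the finite sums in which χ is expressed; note that
-- sumTo f (suc N) = f 0 + sumTo (f ∘ suc) N holds by definition.
sumTo : (ℕ → ℚ) → ℕ → ℚ
sumTo f N = foldr _+_ 0ℚ (applyUpTo f N)

sumTo-pad : ∀ f N M → N ≤ M → (∀ i → N ≤ i → f i ≡ 0ℚ) → sumTo f N ≡ sumTo f M
sumTo-pad f zero zero _ _ = refl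
sumTo-pad f zero (suc M) _ vanish = begin
  0ℚ                           ≡⟨ ℚP.+-identityˡ 0ℚ ⟨
  0ℚ + 0ℚ                      ≡⟨ cong₂ _+_ (vanish 0 z≤n) (sym (sumTo-pad (λ i → f (suc i)) zero M z≤n (λ i _ → vanish (suc i) z≤n))) ⟨
  f 0 + sumTo (λ i → f (suc i)) M ∎
sumTo-pad f (suc N) (suc M) (s≤s N≤M) vanish =
  cong (λ s → f 0 + s) (sumTo-pad (λ i → f (suc i)) N M N≤M (λ i N≤i → vanish (suc i) (s≤s N≤i)))

sumTo-cong : ∀ f g N → (∀ i → f i ≡ g i) → sumTo f N ≡ sumTo g N
sumTo-cong f g zero f≡g = refl
sumTo-cong f g (suc N) f≡g =
  cong₂ _+_ (f≡g 0) (sumTo-cong (λ i → f (suc i)) (λ i → g (suc i)) N (λ i → f≡g (suc i)))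

sumTo-linear : ∀ a b f g N → sumTo (λ i → a * f i - b * g i) N ≡ a * sumTo f N - b * sumTo g N
sumTo-linear a b f g zero = solve 2 (λ a b → con 0ℚ := a :* con 0ℚ :- b :* con 0ℚ) refl a b
sumTo-linear a b f g (suc N) = begin
  (a * f 0 - b * g 0) + sumTo (λ i → a * f (suc i) - b * g (suc i)) N
    ≡⟨ cong (λ s → (a * f 0 - b * g 0) + s) (sumTo-linear a b (λ i → f (suc i)) (λ i → g (suc i)) N) ⟩
  (a * f 0 - b * g 0) + (a * F - b * G)
    ≡⟨ solve 6 (λ a b x y F G → (a :* x :- b :* y) :+ (a :* F :- b :* G) := a :* (x :+ F) :- b :* (y :+ G))
         refl a b (f 0) (g 0) F G ⟩
  a * (f 0 + F) - b * (g 0 + G) ∎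
  where
  F = sumTo (λ i → f (suc i)) N
  G = sumTo (λ i → g (suc i)) N

2*C[1+n,2] : ∀ n → 2 ℕ.* (suc n C 2) ≡ suc n ℕ.* n
2*C[1+n,2] zero = refl
2*C[1+n,2] (suc n) = begin
  2 ℕ.* (suc (suc n) C 2)             ≡⟨ cong (2 ℕ.*_) (nCk+nC[k+1]≡[n+1]C[k+1] (suc n) 1) ⟨
  2 ℕ.* (suc n C 1 ℕ.+ suc n C 2)     ≡⟨ cong (λ z → 2 ℕ.* (z ℕ.+ suc n C 2)) (nC1≡n (suc n)) ⟩
  2 ℕ.* (suc n ℕ.+ suc n C 2)         ≡⟨ ℕP.*-distribˡ-+ 2 (suc n) (suc n C 2) ⟩
  2 ℕ.* suc n ℕ.+ 2 ℕ.* (suc n C 2)   ≡⟨ cong (2 ℕ.* suc n ℕ.+_) (2*C[1+n,2] n) ⟩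
  2 ℕ.* suc n ℕ.+ suc n ℕ.* n         ≡⟨ ℕ-solve (n ∷ []) ⟩
  suc (suc n) ℕ.* suc n ∎

-- Pascal's rule along the anti-diagonal: C(m+1-k,k+1) = C(m-k,k) + C(m-k,k+1).  For k > m
-- the subtraction truncates and both sides are 0.
pascal-shifted : ∀ m k → (suc m ∸ k) C suc k ≡ (m ∸ k) C k ℕ.+ (m ∸ k) C suc k
pascal-shifted m k with k ℕ.≤? m
... | yes k≤m rewrite ℕP.+-∸-assoc 1 k≤m = sym (nCk+nC[k+1]≡[n+1]C[k+1] (m ∸ k) k)
... | no k≰m rewrite ℕP.m≤n⇒m∸n≡0 (ℕP.≰⇒> k≰m) | ℕP.m≤n⇒m∸n≡0 (ℕP.<⇒≤ (ℕP.≰⇒> k≰m)) =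
  sym (cong (ℕ._+ 0) (k>n⇒nCk≡0 (ℕP.≤-trans (s≤s z≤n) (ℕP.≰⇒> k≰m))))

⌊n/2⌋<k⇒n<k+k : ∀ n k → ⌊ n /2⌋ < k → n < k ℕ.+ k
⌊n/2⌋<k⇒n<k+k zero (suc k) _ = s≤s z≤n
⌊n/2⌋<k⇒n<k+k (suc zero) (suc k) _ = s≤s (ℕP.≤-trans (s≤s z≤n) (ℕP.m≤n+m (suc k) k))
⌊n/2⌋<k⇒n<k+k (suc (suc n)) (suc k) (s≤s ⌊n/2⌋<k) =
  s≤s (subst (suc (suc n) ≤_) (sym (ℕP.+-suc k k)) (s≤s (⌊n/2⌋<k⇒n<k+k n k ⌊n/2⌋<k)))

fromℕ-suc-! : ∀ n → fromℕ (suc n !) ≡ fromℕ (suc n) * fromℕ (n !)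
fromℕ-suc-! n = sym (fromℕ-* (suc n) (n !))

fromℕ-C[1+n,2] : ∀ n → fromℕ (suc n C 2) ≡ fromℕ (suc n) * fromℕ n * half
fromℕ-C[1+n,2] n = begin
  c                      ≡⟨ solve 1 (λ c → c := con (fromℕ 2) :* c :* con half) refl c ⟩
  fromℕ 2 * c * half     ≡⟨ cong (_* half) (fromℕ-* 2 (suc n C 2)) ⟩
  fromℕ (2 ℕ.* (suc n C 2)) * half ≡⟨ cong (λ z → fromℕ z * half) (2*C[1+n,2] n) ⟩
  fromℕ (suc n ℕ.* n) * half ≡⟨ cong (_* half) (fromℕ-* (suc n) n) ⟨
  fromℕ (suc n) * fromℕ n * half ∎
  where c = fromℕ (suc n C 2)

term-factored : ∀ n k → term n k ≡ sign k * (fromℕ (n !) * half^ k * fromℕ ((n ∸ k) C k))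
term-factored n k = cong (λ z → sign k * (z * fromℕ ((n ∸ k) C k))) (/2^-as-product (n !) k)

-- T(n,k) = 0 for k > ⌊n/2⌋, since then n - k < k and the binomial coefficient vanishes.
term-vanishes : ∀ n k → ⌊ n /2⌋ < k → term n k ≡ 0ℚ
term-vanishes n k ⌊n/2⌋<k = begin
  term n k                                                 ≡⟨ term-factored n k ⟩
  sign k * (fromℕ (n !) * half^ k * fromℕ ((n ∸ k) C k))   ≡⟨ cong (λ z → sign k * (fromℕ (n !) * half^ k * fromℕ z)) C≡0 ⟩
  sign k * (fromℕ (n !) * half^ k * 0ℚ)                    ≡⟨ solve 2 (λ s a → s :* (a :* con 0ℚ) := con 0ℚ) refl (sign k) (fromℕ (n !) * half^ k) ⟩
  0ℚ ∎
  where
  C≡0 : (n ∸ k) C k ≡ 0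
  C≡0 = k>n⇒nCk≡0 (ℕP.m<n+o⇒m∸n<o n k {{ℕ.>-nonZero (ℕP.≤-trans (s≤s z≤n) ⌊n/2⌋<k)}} (⌊n/2⌋<k⇒n<k+k n k ⌊n/2⌋<k))

term-head : ∀ n → term (suc n) 0 ≡ fromℕ (suc n) * term n 0
term-head n = begin
  term (suc n) 0                                          ≡⟨ term-factored (suc n) 0 ⟩
  1ℚ * (fromℕ (suc n !) * half^ 0 * fromℕ 1)              ≡⟨ cong (λ z → 1ℚ * (z * half^ 0 * fromℕ 1)) (fromℕ-suc-! n) ⟩
  1ℚ * (fromℕ (suc n) * fromℕ (n !) * half^ 0 * fromℕ 1)
    ≡⟨ solve 3 (λ q f d → con 1ℚ :* (q :* f :* d :* con (fromℕ 1)) := q :* (con 1ℚ :* (f :* d :* con (fromℕ 1))))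
         refl (fromℕ (suc n)) (fromℕ (n !)) (half^ 0) ⟩
  fromℕ (suc n) * (1ℚ * (fromℕ (n !) * half^ 0 * fromℕ 1)) ≡⟨ cong (fromℕ (suc n) *_) (term-factored n 0) ⟨
  fromℕ (suc n) * term n 0 ∎

term-step : ∀ m k → term (suc (suc m)) (suc k)
                  ≡ fromℕ (suc (suc m)) * term (suc m) (suc k) - fromℕ (suc (suc m) C 2) * term m k
term-step m k = begin
  term (suc (suc m)) (suc k)
    ≡⟨ term-factored (suc (suc m)) (suc k) ⟩
  - s * (fromℕ (suc (suc m) !) * half^ (suc k) * fromℕ ((suc m ∸ k) C suc k))
    ≡⟨ cong₂ (λ A B → - s * (A * B)) (cong₂ _*_ (trans (fromℕ-suc-! (suc m)) (cong (q *_) (fromℕ-suc-! m))) (half^-suc k)) binomial ⟩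
  - s * (q * (p * f) * (d * half) * (x + y))
    ≡⟨ solve 8 (λ s f p q d h x y → (:- s) :* (q :* (p :* f) :* (d :* h) :* (x :+ y))
                                   := q :* ((:- s) :* (p :* f :* (d :* h) :* y)) :- (q :* p :* h) :* (s :* (f :* d :* x)))
         refl s f p q d half x y ⟩
  q * (- s * (p * f * (d * half) * y)) - (q * p * half) * (s * (f * d * x))
    ≡⟨ cong₂ (λ A B → q * A - B * (s * (f * d * x))) (sym predecessor) (sym (fromℕ-C[1+n,2] (suc m))) ⟩
  q * term (suc m) (suc k) - fromℕ (suc (suc m) C 2) * (s * (f * d * x))
    ≡⟨ cong (λ z → q * term (suc m) (suc k) - fromℕ (suc (suc m) C 2) * z) (term-factored m k) ⟨
  q * term (suc m) (suc k) - fromℕ (suc (suc m) C 2) * term m k ∎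
  where
  s = sign k
  f = fromℕ (m !)
  p = fromℕ (suc m)
  q = fromℕ (suc (suc m))
  d = half^ k
  x = fromℕ ((m ∸ k) C k)
  y = fromℕ ((m ∸ k) C suc k)

  binomial : fromℕ ((suc m ∸ k) C suc k) ≡ x + y
  binomial = trans (cong fromℕ (pascal-shifted m k)) (sym (fromℕ-+ ((m ∸ k) C k) ((m ∸ k) C suc k)))

  predecessor : term (suc m) (suc k) ≡ - s * (p * f * (d * half) * y)
  predecessor = trans (term-factored (suc m) (suc k))
    (cong (λ A → - s * (A * y)) (cong₂ _*_ (fromℕ-suc-! m) (half^-suc k)))

χ-as-sum : ∀ n M → n < M → χ n ≡ sumTo (term n) M
χ-as-sum n M n<M = trans (cong (foldr _+_ 0ℚ) (map-upTo (term n) (suc ⌊ n /2⌋)))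
  (sumTo-pad (term n) (suc ⌊ n /2⌋) M (ℕP.≤-trans (s≤s (ℕP.⌊n/2⌋≤n n)) n<M) (term-vanishes n))

χ-recurrence : ∀ m → χ (suc (suc m)) ≡ fromℕ (suc (suc m)) * χ (suc m) - fromℕ (suc (suc m) C 2) * χ m
χ-recurrence m = begin
  χ n
    ≡⟨ χ-as-sum n (suc n) ℕP.≤-refl ⟩
  term n 0 + sumTo (λ k → term n (suc k)) n
    ≡⟨ cong₂ _+_ (term-head (suc m)) (sumTo-cong _ _ n (term-step m)) ⟩
  q * term (suc m) 0 + sumTo (λ k → q * term (suc m) (suc k) - c * term m k) n
    ≡⟨ cong (λ s → q * term (suc m) 0 + s) (sumTo-linear q c (λ k → term (suc m) (suc k)) (term m) n) ⟩
  q * term (suc m) 0 + (q * A - c * B)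
    ≡⟨ solve 5 (λ q c t A B → q :* t :+ (q :* A :- c :* B) := q :* (t :+ A) :- c :* B) refl q c (term (suc m) 0) A B ⟩
  q * sumTo (term (suc m)) (suc n) - c * B
    ≡⟨ cong₂ (λ X Y → q * X - c * Y) (χ-as-sum (suc m) (suc n) (ℕP.n≤1+n n)) (χ-as-sum m n (ℕP.n≤1+n (suc m))) ⟨
  q * χ (suc m) - c * χ m ∎
  where
  n = suc (suc m)
  q = fromℕ n
  c = fromℕ (n C 2)
  A = sumTo (λ k → term (suc m) (suc k)) n
  B = sumTo (term m) n

theorem6p3 : (χ 1 ≡ 1ℚ × χ 2 ≡ 1ℚ)
    × (∀ (n : ℕ) → n ≥ 3 → χ n ≡ fromℕ n * χ (n ∸ 1) - choose2 n * χ (n ∸ 2))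
theorem6p3 = (refl , refl) , recurrence
  where
  recurrence : ∀ (n : ℕ) → n ≥ 3 → χ n ≡ fromℕ n * χ (n ∸ 1) - choose2 n * χ (n ∸ 2)
  recurrence (suc (suc m)) _ = χ-recurrence m
  recurrence (suc zero) (s≤s ())
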